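{- Let $G=(V,E)$, $n,m$, $t$ and $\mathcal{M}=\mathcal{M}(G)$ be as in the context. Let $\mathcal{V}$ be an $n$-element subset of the column index set of $\mathcal{M}$ and let $S$ be the submatrix of $\mathcal{M}$ formed by the columns with indexes in $\mathcal{V}$. If $\min_{A}\|\mathcal{M}-SA\|\leqslant\sqrt{mt^2+4nt^6+mt^{10}}$ (with $A$ ranging over real $n\times(3n+m)$ matrices), equivalently $\|(I-SS^+)\mathcal{M}\|\leqslant\sqrt{mt^2+4nt^6+mt^{10}}$, then there is a map $\psi:V\to\{1,2,3\}$ such that $\mathcal{V}=\{v^{\psi(v)}: v\in V\}$.
   Context: $G=(V,E)$ is a simple graph with $n=|V|\geqslant1$ vertices and $m=|E|\geqslant1$ edges; $\|\cdot\|$ is the Frobenius norm; $X^+$ denotes the Moore–Penrose pseudoinverse of $X$. Set $t=\frac{1}{4(m+n)^3}$. For $i\in\{1,2,3\}$ let $V^i=\{v^i: v\in V\}$ be a disjoint copy of $V$. The matrix $\mathcal{M}$ has rows indexed by $V\cup\{1,2,3\}\cup\{\varepsilon\}$ and columns indexed by $V^1\cup V^2\cup V^3\cup E$, with entries, for all distinct $u,v\in V$, distinct $i,j\in\{1,2,3\}$, and $e\in E$: $\mathcal{M}(u,u^i)=1$, $\mathcal{M}(u,v^i)=0$; $\mathcal{M}(u,e)=t^2$ if $u\in e$ and $0$ otherwise; $\mathcal{M}(i,v^i)=t^3$, $\mathcal{M}(i,v^j)=0$, $\mathcal{M}(i,e)=t^5$; $\mathcal{M}(\varepsilon,v^i)=0$,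 $\mathcal{M}(\varepsilon,e)=t$.
   Formalization: In the hypothesis, A ranges over rational $n\times(3n+m)$ matrices instead of real ones. -}

module Defs where

open import Data.Nat as ℕ using (ℕ; zero; suc; NonZero)
open import Data.Nat.Properties using (m*n≢0; m^n≢0)
open import Data.Integer using (+_)
open import Data.Rational using (ℚ; 0ℚ; 1ℚ; _+_; _*_; _-_; _/_; _≤_)
open import Data.Fin using (Fin; _<_; _≟_) renaming (zero to fzero; suc to fsuc)
open import Data.Product using (_×_; _,_; proj₁; proj₂; Σ; ∃)
open import Data.Sum using (_⊎_; inj₁; inj₂)
open import Data.Unit using (⊤; tt)
open import Relation.Nullary using (yes; no)
open import Relation.Binary.PropositionalEquality using (_≡_)

_^ℚ_ : ℚ → ℕ → ℚ
q ^ℚ zero  = 1ℚ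
q ^ℚ suc k = q * (q ^ℚ k)

sumFin : (k : ℕ) → (Fin k → ℚ) → ℚ
sumFin zero    f = 0ℚ
sumFin (suc k) f = f fzero + sumFin k (λ i → f (fsuc i))

private
  nz+ : ∀ m n → .{{NonZero n}} → NonZero (m ℕ.+ n)
  nz+ zero    (suc n) = _
  nz+ (suc m) n       = _

-- A simple graph on vertex set Fin n with m edges: edge e joins
-- proj₁ (edge e) < proj₂ (edge e) (no loops, orientation fixed),
-- and distinct edge labels are distinct edges (no multi-edges).
record SimpleGraph (n m : ℕ) : Set where
  field
    edge     : Fin m → Fin n × Fin n
    ordered  : ∀ e → proj₁ (edge e) < proj₂ (edge e)
    distinct : ∀ e f → edge e ≡ edge f → e ≡ f

-- Row index set  V ∪ {1,2,3} ∪ {ε}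
Row : ℕ → Set
Row n = Fin n ⊎ (Fin 3 ⊎ ⊤)

-- Column index set  V¹ ∪ V² ∪ V³ ∪ E ; inj₁ (i , v) is v^(i+1)
Col : ℕ → ℕ → Set
Col n m = (Fin 3 × Fin n) ⊎ Fin m

sumRow : (n : ℕ) → (Row n → ℚ) → ℚ
sumRow n f = sumFin n (λ v → f (inj₁ v))
           + (sumFin 3 (λ i → f (inj₂ (inj₁ i))) + f (inj₂ (inj₂ tt)))

sumCol : (n m : ℕ) → (Col n m → ℚ) → ℚ
sumCol n m f = sumFin 3 (λ i → sumFin n (λ v → f (inj₁ (i , v))))
             + sumFin m (λ e → f (inj₂ e))

t : (n m : ℕ) → .{{NonZero n}} → ℚ
t n m = _/_ (+ 1) (4 ℕ.* (m ℕ.+ n) ℕ.^ 3)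
  {{m*n≢0 4 ((m ℕ.+ n) ℕ.^ 3) {{_}} {{m^n≢0 (m ℕ.+ n) 3 {{nz+ m n}}}}}}

private
  eqB : ∀ {k} → Fin k → Fin k → ℚ → ℚ
  eqB a b q with a ≟ b
  ... | yes _ = q
  ... | no  _ = 0ℚ

𝓜 : (n m : ℕ) → .{{NonZero n}} → SimpleGraph n m → Row n → Col n m → ℚ
𝓜 n m G (inj₁ u) (inj₁ (i , v)) = eqB u v 1ℚ
𝓜 n m G (inj₁ u) (inj₂ e) with u ≟ proj₁ (SimpleGraph.edge G e) | u ≟ proj₂ (SimpleGraph.edge G e)
... | no _ | no _ = 0ℚ
... | _    | _    = t n m ^ℚ 2
𝓜 n m G (inj₂ (inj₁ j)) (inj₁ (i , v)) = eqB j i (t n m ^ℚ 3)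
𝓜 n m G (inj₂ (inj₁ j)) (inj₂ e) = t n m ^ℚ 5
𝓜 n m G (inj₂ (inj₂ tt)) (inj₁ _) = 0ℚ
𝓜 n m G (inj₂ (inj₂ tt)) (inj₂ e) = t n m

-- squared Frobenius norm of 𝓜 - S A, where S is the submatrix of 𝓜 with
-- columns σ 0, …, σ (n-1) and A is an n × (3n+m) matrix
residual² : (n m : ℕ) → .{{NonZero n}} → SimpleGraph n m →
            (Fin n → Col n m) → (Fin n → Col n m → ℚ) → ℚ
residual² n m G σ A = sumRow n (λ r → sumCol n m (λ c →
  let d = 𝓜 n m G r c - sumFin n (λ k → 𝓜 n m G r (σ k) * A k c) in d * d))

-- the bound  m t² + 4 n t⁶ + m t¹⁰  (square of the paper's bound)
bound² : (n m : ℕ) → .{{NonZero n}} → ℚ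
bound² n m = ((+ m) / 1) * (t n m ^ℚ 2)
           + ((+ (4 ℕ.* n)) / 1) * (t n m ^ℚ 6)
           + ((+ m) / 1) * (t n m ^ℚ 10)

{-# OPTIONS --safe #-}
module Submission where

-- If a row vector y annihilates the selected columns S, then yᵀ(𝓜 - SA) = yᵀ𝓜, and
-- Cauchy–Schwarz column by column gives ‖yᵀ𝓜‖² ≤ ‖y‖² ‖𝓜 - SA‖².  For y supported on the
-- rows V ∪ {ε}, yᵀ𝓜 repeats y on each of the three copies of V, so ‖yᵀ𝓜‖² ≥ 3 ‖y_V‖²; if
-- also y_ε² ≤ n t² ‖y_V‖², the hypothesis ‖𝓜 - SA‖² ≤ m t² + 4n t⁶ + m t¹⁰ < 1 is violated.
-- Such a y exists if S contains an edge column (the n + 1 rows V ∪ {ε} of S are dependent)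
-- and if some vertex has no selected copy (its indicator).  So the n columns of S are vertex
-- columns covering all n vertices, one copy of each.

open import Defs
open import Data.Nat as ℕ using (ℕ; zero; suc; NonZero)
import Data.Nat.Properties as ℕ
import Data.Integer as ℤ
import Data.Integer.Properties as ℤ
open import Data.Nat.Coprimality as Coprime using (1-coprimeTo)
open import Data.Rational as ℚ using (ℚ; 0ℚ; 1ℚ; _+_; _*_; _-_; -_; _÷_; _/_; _≤_; _<_; mkℚ; *≤*; *<*)
open import Data.Rational.Properties hiding (_≟_)
open import Data.Rational.Solver using (module +-*-Solver)
open import Data.Fin using (Fin; _≟_; punchIn; punchOut) renaming (zero to fzero; suc to fsuc)
open import Data.Fin.Properties using (all?; any?; ¬∀⟶∃¬; punchIn-punchOut; punchOut-injective; suc-injective; injective⇒≤)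
open import Data.Product using (_×_; _,_; proj₁; proj₂; ∃)
open import Data.Sum using (_⊎_; inj₁; inj₂; [_,_]′)
open import Data.Sum.Properties using (≡-dec; inj₁-injective)
open import Data.Product.Properties using () renaming (≡-dec to ×-≡-dec)
open import Data.Unit using (⊤; tt)
open import Data.Empty using (⊥; ⊥-elim)
open import Function using (_∘_; id; _⇔_; mk⇔)
open import Function.Definitions using (Injective)
open import Relation.Binary.Definitions using (tri<; tri≈; tri>)
open import Relation.Nullary using (Dec; yes; no; ¬_; ¬?; contradiction)
open import Relation.Nullary.Decidable using (decidable-stable)
open import Relation.Binary.PropositionalEquality

open import Algebra.Bundles using (CommutativeMonoid)
open import Algebra.Properties.CommutativeSemigroup (CommutativeMonoid.commutativeSemigroup +-0-commutativeMonoid)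
  using () renaming (interchange to +-interchange)
open +-*-Solver using (solve; _:=_; _:+_; _:*_; :-_; _:-_; con)

p≢0⇒0<p*p : ∀ {p} → p ≢ 0ℚ → 0ℚ < p * p
p≢0⇒0<p*p {p} p≢0 with <-cmp p 0ℚ
... | tri< p<0 _ _ = positive⁻¹ _ {{neg*neg⇒pos p {{ℚ.negative p<0}} p {{ℚ.negative p<0}}}}
... | tri≈ _ p≡0 _ = contradiction p≡0 p≢0
... | tri> _ _ p>0 = positive⁻¹ _ {{pos*pos⇒pos p {{ℚ.positive p>0}} p {{ℚ.positive p>0}}}}

0≤p*p : ∀ p → 0ℚ ≤ p * p
0≤p*p p with p ℚ.≟ 0ℚ
... | yes refl = ≤-refl
... | no  p≢0  = <⇒≤ (p≢0⇒0<p*p p≢0)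

p≤p+q : ∀ {p q} → 0ℚ ≤ q → p ≤ p + q
p≤p+q {p} {q} 0≤q = subst (_≤ p + q) (+-identityʳ p) (+-monoʳ-≤ p 0≤q)

p*q≡0⇒p≡0 : ∀ {p} q .{{_ : ℚ.NonZero q}} → p * q ≡ 0ℚ → p ≡ 0ℚ
p*q≡0⇒p≡0 {p} q pq≡0 = begin
  p                  ≡⟨ *-identityʳ p ⟨
  p * 1ℚ             ≡⟨ cong (p *_) (*-inverseʳ q) ⟨
  p * (q * ℚ.1/ q)   ≡⟨ *-assoc p q (ℚ.1/ q) ⟨
  p * q * ℚ.1/ q     ≡⟨ cong (_* ℚ.1/ q) pq≡0 ⟩
  0ℚ * ℚ.1/ q        ≡⟨ *-zeroˡ (ℚ.1/ q) ⟩
  0ℚ                 ∎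
  where open ≡-Reasoning

*-mono-≤-nonNeg : ∀ {p q r s} → 0ℚ ≤ p → p ≤ q → 0ℚ ≤ r → r ≤ s → p * r ≤ q * s
*-mono-≤-nonNeg {p} {q} {r} {s} 0≤p p≤q 0≤r r≤s =
  ≤-trans (*-monoʳ-≤-nonNeg r {{ℚ.nonNegative 0≤r}} p≤q) (*-monoˡ-≤-nonNeg q {{ℚ.nonNegative (≤-trans 0≤p p≤q)}} r≤s)

0≤1 : 0ℚ ≤ 1ℚ
0≤1 = *≤* (ℤ.+≤+ ℕ.z≤n)

0≤p*q : ∀ {p q} → 0ℚ ≤ p → 0ℚ ≤ q → 0ℚ ≤ p * q
0≤p*q 0≤p 0≤q = *-mono-≤-nonNeg ≤-refl 0≤p ≤-refl 0≤q

0<p^k : ∀ {p} → 0ℚ < p → ∀ k → 0ℚ < p ^ℚ k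
0<p^k 0<p zero    = *<* (ℤ.+<+ (ℕ.s≤s ℕ.z≤n))
0<p^k {p} 0<p (suc k) = positive⁻¹ _ {{pos*pos⇒pos p {{ℚ.positive 0<p}} (p ^ℚ k) {{ℚ.positive (0<p^k 0<p k)}}}}

0≤p^k : ∀ {p} → 0ℚ ≤ p → ∀ k → 0ℚ ≤ p ^ℚ k
0≤p^k 0≤p zero    = 0≤1
0≤p^k 0≤p (suc k) = 0≤p*q 0≤p (0≤p^k 0≤p k)

p^[1+k]≤p : ∀ {p} → 0ℚ ≤ p → p ≤ 1ℚ → ∀ k → p ^ℚ suc k ≤ p
p^[1+k]≤p {p} 0≤p p≤1 zero    = ≤-reflexive (*-identityʳ p)
p^[1+k]≤p {p} 0≤p p≤1 (suc k) = ≤-trans (*-mono-≤-nonNeg 0≤p p≤1 (0≤p^k 0≤p (suc k)) ≤-refl)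
  (subst (_≤ p) (sym (*-identityˡ _)) (p^[1+k]≤p 0≤p p≤1 k))

c*p^[2+k]≤p : ∀ {c p} → 0ℚ ≤ c → 0ℚ ≤ p → p ≤ 1ℚ → c * p ≤ 1ℚ → ∀ k → c * p ^ℚ suc (suc k) ≤ p
c*p^[2+k]≤p {c} {p} 0≤c 0≤p p≤1 cp≤1 k = begin
  c * (p * p ^ℚ suc k)   ≡⟨ *-assoc c p _ ⟨
  (c * p) * p ^ℚ suc k   ≤⟨ *-mono-≤-nonNeg (0≤p*q 0≤c 0≤p) cp≤1
                             (0≤p^k 0≤p (suc k)) (p^[1+k]≤p 0≤p p≤1 k) ⟩
  1ℚ * p                 ≡⟨ *-identityˡ p ⟩
  p                      ∎
  where open ≤-Reasoning

ι : ℕ → ℚ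
ι k = ℤ.+ k / 1

ι≡mkℚ : ∀ k → ι k ≡ mkℚ (ℤ.+ k) 0 (Coprime.sym (1-coprimeTo k))
ι≡mkℚ k = normalize-coprime (Coprime.sym (1-coprimeTo k))

ι-suc : ∀ k → ι (suc k) ≡ 1ℚ + ι k
ι-suc k = trans (cong (λ i → ℤ._+_ (ℤ.+ 1) i / 1) (sym (ℤ.*-identityʳ (ℤ.+ k)))) (cong (1ℚ +_) (sym (ι≡mkℚ k)))

ι-mono-≤ : ∀ {a b} → a ℕ.≤ b → ι a ≤ ι b
ι-mono-≤ {a} {b} a≤b rewrite ι≡mkℚ a | ι≡mkℚ b =
  *≤* (subst₂ ℤ._≤_ (sym (ℤ.*-identityʳ (ℤ.+ a))) (sym (ℤ.*-identityʳ (ℤ.+ b))) (ℤ.+≤+ a≤b))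

ι-nonNeg : ∀ k → 0ℚ ≤ ι k
ι-nonNeg k = nonNegative⁻¹ (ι k) {{normalize-nonNeg k 1}}

1/d*ι[d]≡1 : ∀ d .{{_ : NonZero d}} → (ℤ.+ 1 / d) * ι d ≡ 1ℚ
1/d*ι[d]≡1 (suc d) = trans (cong₂ _*_ (normalize-coprime (1-coprimeTo (suc d))) (ι≡mkℚ (suc d)))
  (*-inverseˡ (mkℚ (ℤ.+ suc d) 0 (Coprime.sym (1-coprimeTo (suc d)))))

ι2<ι4 : ι 2 < ι 4
ι2<ι4 = *<* (ℤ.+<+ (ℕ.s≤s (ℕ.s≤s (ℕ.s≤s ℕ.z≤n))))

record Summation (I : Set) : Set where
  field
    ∑           : (I → ℚ) → ℚ
    ∑-cong      : ∀ {f g} → (∀ i → f i ≡ g i) → ∑ f ≡ ∑ g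
    ∑-distrib-+ : ∀ f g → ∑ (λ i → f i + g i) ≡ ∑ f + ∑ g
    *-distribˡ-∑ : ∀ c f → c * ∑ f ≡ ∑ (λ i → c * f i)
    ∑-mono-≤    : ∀ {f g} → (∀ i → f i ≤ g i) → ∑ f ≤ ∑ g

  ‖_‖² : (I → ℚ) → ℚ
  ‖ f ‖² = ∑ (λ i → f i * f i)

  _ᵀ·_ : ∀ {J : Set} → (I → ℚ) → (I → J → ℚ) → J → ℚ
  (y ᵀ· N) j = ∑ (λ i → y i * N i j)

  ∑-zero : ∑ (λ _ → 0ℚ) ≡ 0ℚ
  ∑-zero = begin
    ∑ (λ _ → 0ℚ)         ≡⟨ ∑-cong (λ _ → sym (*-zeroˡ 0ℚ)) ⟩
    ∑ (λ _ → 0ℚ * 0ℚ)    ≡⟨ *-distribˡ-∑ 0ℚ (λ _ → 0ℚ) ⟨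
    0ℚ * ∑ (λ _ → 0ℚ)    ≡⟨ *-zeroˡ (∑ (λ _ → 0ℚ)) ⟩
    0ℚ                   ∎
    where open ≡-Reasoning

  ∑-nonNeg : ∀ {f} → (∀ i → 0ℚ ≤ f i) → 0ℚ ≤ ∑ f
  ∑-nonNeg {f} 0≤f = subst (_≤ ∑ f) ∑-zero (∑-mono-≤ 0≤f)

  ∑-distrib-- : ∀ f g → ∑ (λ i → f i - g i) ≡ ∑ f - ∑ g
  ∑-distrib-- f g = begin
    ∑ (λ i → f i - g i)            ≡⟨ ∑-cong (λ i → solve 2 (λ x y → x :- y := x :+ con (- 1ℚ) :* y) refl (f i) (g i)) ⟩
    ∑ (λ i → f i + (- 1ℚ) * g i)    ≡⟨ ∑-distrib-+ f _ ⟩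
    ∑ f + ∑ (λ i → (- 1ℚ) * g i)    ≡⟨ cong (∑ f +_) (*-distribˡ-∑ (- 1ℚ) g) ⟨
    ∑ f + (- 1ℚ) * ∑ g              ≡⟨ solve 2 (λ x y → x :+ con (- 1ℚ) :* y := x :- y) refl (∑ f) (∑ g) ⟩
    ∑ f - ∑ g                       ∎
    where open ≡-Reasoning

  -- With r = A b - C a one has ‖ r ‖² = A (A B - C²) ≥ 0.
  cauchy-schwarz : ∀ (a b : I → ℚ) → 0ℚ < ‖ a ‖² →
    ∑ (λ i → a i * b i) * ∑ (λ i → a i * b i) ≤ ‖ a ‖² * ‖ b ‖²
  cauchy-schwarz a b 0<A = *-cancelˡ-≤-pos A {{ℚ.positive 0<A}} (begin
    A * (C * C)                                ≤⟨ p≤p+q (∑-nonNeg {λ i → r i * r i} (λ i → 0≤p*p (r i))) ⟩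
    A * (C * C) + ‖ r ‖²                       ≡⟨ cong (A * (C * C) +_) ‖r‖² ⟩
    A * (C * C) + (A * (A * B) - A * (C * C))  ≡⟨ solve 2 (λ x y → x :+ (y :- x) := y) refl (A * (C * C)) (A * (A * B)) ⟩
    A * (A * B)                                ∎)
    where
    open ≤-Reasoning
    A = ‖ a ‖²
    B = ‖ b ‖²
    C = ∑ (λ i → a i * b i)
    r : I → ℚ
    r i = A * b i - C * a i
    ‖r‖² : ‖ r ‖² ≡ A * (A * B) - A * (C * C)
    ‖r‖² = begin-equality
      ‖ r ‖²
        ≡⟨ ∑-cong (λ i → solve 4 (λ A C x y → (A :* y :- C :* x) :* (A :* y :- C :* x)
             := (A :* A) :* (y :* y) :- ((A :+ A) :* C) :* (x :* y) :+ (C :* C) :* (x :* x)) refl A C (a i) (b i)) ⟩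
      ∑ (λ i → u i - v i + w i)      ≡⟨ ∑-distrib-+ (λ i → u i - v i) w ⟩
      ∑ (λ i → u i - v i) + ∑ w      ≡⟨ cong (_+ ∑ w) (∑-distrib-- u v) ⟩
      ∑ u - ∑ v + ∑ w
        ≡⟨ cong₂ _+_ (cong₂ _-_ (*-distribˡ-∑ (A * A) (λ i → b i * b i)) (*-distribˡ-∑ ((A + A) * C) (λ i → a i * b i)))
                     (*-distribˡ-∑ (C * C) (λ i → a i * a i)) ⟨
      (A * A) * B - ((A + A) * C) * C + (C * C) * A
        ≡⟨ solve 3 (λ A B C → (A :* A) :* B :- ((A :+ A) :* C) :* C :+ (C :* C) :* A
             := A :* (A :* B) :- A :* (C :* C)) refl A B C ⟩
      A * (A * B) - A * (C * C) ∎
      where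
      u v w : I → ℚ
      u i = (A * A) * (b i * b i)
      v i = ((A + A) * C) * (a i * b i)
      w i = (C * C) * (a i * a i)

open Summation hiding (‖_‖²; _ᵀ·_)

sumFin-cong : ∀ k {f g : Fin k → ℚ} → (∀ i → f i ≡ g i) → sumFin k f ≡ sumFin k g
sumFin-cong zero    f≡g = refl
sumFin-cong (suc k) f≡g = cong₂ _+_ (f≡g fzero) (sumFin-cong k (f≡g ∘ fsuc))

sumFin-distrib-+ : ∀ k (f g : Fin k → ℚ) → sumFin k (λ i → f i + g i) ≡ sumFin k f + sumFin k g
sumFin-distrib-+ zero    f g = refl
sumFin-distrib-+ (suc k) f g = trans (cong (f fzero + g fzero +_) (sumFin-distrib-+ k (f ∘ fsuc) (g ∘ fsuc)))
  (+-interchange (f fzero) (g fzero) (sumFin k (f ∘ fsuc)) (sumFin k (g ∘ fsuc)))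

*-distribˡ-sumFin : ∀ k c (f : Fin k → ℚ) → c * sumFin k f ≡ sumFin k (λ i → c * f i)
*-distribˡ-sumFin zero    c f = *-zeroʳ c
*-distribˡ-sumFin (suc k) c f = trans (*-distribˡ-+ c _ _) (cong (c * f fzero +_) (*-distribˡ-sumFin k c (f ∘ fsuc)))

sumFin-mono-≤ : ∀ k {f g : Fin k → ℚ} → (∀ i → f i ≤ g i) → sumFin k f ≤ sumFin k g
sumFin-mono-≤ zero    f≤g = ≤-refl
sumFin-mono-≤ (suc k) f≤g = +-mono-≤ (f≤g fzero) (sumFin-mono-≤ k (f≤g ∘ fsuc))

*-distribʳ-sumFin : ∀ k c (f : Fin k → ℚ) → sumFin k f * c ≡ sumFin k (λ i → f i * c)
*-distribʳ-sumFin k c f = trans (*-comm (sumFin k f) c) (trans (*-distribˡ-sumFin k c f) (sumFin-cong k (λ i → *-comm c (f i))))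

finSummation : ∀ k → Summation (Fin k)
finSummation k = record
  { ∑ = sumFin k
  ; ∑-cong = sumFin-cong k
  ; ∑-distrib-+ = sumFin-distrib-+ k
  ; *-distribˡ-∑ = *-distribˡ-sumFin k
  ; ∑-mono-≤ = sumFin-mono-≤ k
  }

sumFin-concentrated : ∀ k (f : Fin k → ℚ) w → (∀ v → v ≢ w → f v ≡ 0ℚ) → sumFin k f ≡ f w
sumFin-concentrated (suc k) f fzero f≡0 = begin
  f fzero + sumFin k (f ∘ fsuc)
    ≡⟨ cong (f fzero +_) (trans (sumFin-cong k (λ v → f≡0 (fsuc v) λ ())) (∑-zero (finSummation k))) ⟩
  f fzero + 0ℚ
    ≡⟨ +-identityʳ (f fzero) ⟩
  f fzero ∎
  where open ≡-Reasoning
sumFin-concentrated (suc k) f (fsuc w) f≡0 = begin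
  f fzero + sumFin k (f ∘ fsuc)
    ≡⟨ cong₂ _+_ (f≡0 fzero λ ()) (sumFin-concentrated k (f ∘ fsuc) w (λ v v≢w → f≡0 (fsuc v) (v≢w ∘ suc-injective))) ⟩
  0ℚ + f (fsuc w)
    ≡⟨ +-identityˡ (f (fsuc w)) ⟩
  f (fsuc w) ∎
  where open ≡-Reasoning

sumFin-const : ∀ k c → sumFin k (λ _ → c) ≡ ι k * c
sumFin-const zero    c = sym (*-zeroˡ c)
sumFin-const (suc k) c = begin
  c + sumFin k (λ _ → c)  ≡⟨ cong (c +_) (sumFin-const k c) ⟩
  c + ι k * c             ≡⟨ solve 2 (λ c i → c :+ i :* c := (con 1ℚ :+ i) :* c) refl c (ι k) ⟩
  (1ℚ + ι k) * c          ≡⟨ cong (_* c) (ι-suc k) ⟨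
  ι (suc k) * c           ∎
  where open ≡-Reasoning

term≤sumFin : ∀ k (f : Fin k → ℚ) w → (∀ v → 0ℚ ≤ f v) → f w ≤ sumFin k f
term≤sumFin (suc k) f fzero    0≤f = p≤p+q (∑-nonNeg (finSummation k) (0≤f ∘ fsuc))
term≤sumFin (suc k) f (fsuc w) 0≤f = subst (_≤ sumFin (suc k) f) (+-identityˡ (f (fsuc w)))
  (+-mono-≤ (0≤f fzero) (term≤sumFin k (f ∘ fsuc) w (0≤f ∘ fsuc)))

0<∑f² : ∀ {k} (f : Fin k → ℚ) w → f w ≢ 0ℚ → 0ℚ < sumFin k (λ v → f v * f v)
0<∑f² {k} f w fw≢0 = <-≤-trans (p≢0⇒0<p*p fw≢0) (term≤sumFin k (λ v → f v * f v) w (λ v → 0≤p*p (f v)))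

0<∑f²⊎f≡0 : ∀ {k} (f : Fin k → ℚ) → 0ℚ < sumFin k (λ v → f v * f v) ⊎ (∀ v → f v ≡ 0ℚ)
0<∑f²⊎f≡0 f with any? (λ v → ¬? (f v ℚ.≟ 0ℚ))
... | yes (w , fw≢0) = inj₁ (0<∑f² f w fw≢0)
... | no  ∄fv≢0      = inj₂ (λ v → decidable-stable (f v ℚ.≟ 0ℚ) (λ fv≢0 → ∄fv≢0 (v , fv≢0)))

indicator : ∀ {k} → Fin k → Fin k → ℚ
indicator u v with v ≟ u
... | yes _ = 1ℚ
... | no  _ = 0ℚ

indicator-off : ∀ {k} (u v : Fin k) → v ≢ u → indicator u v ≡ 0ℚ
indicator-off u v v≢u with v ≟ u
... | yes v≡u = ⊥-elim (v≢u v≡u)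
... | no  _   = refl

indicator-on : ∀ {k} (u : Fin k) → indicator u u ≢ 0ℚ
indicator-on u with u ≟ u
... | yes _  = 1≢0
... | no u≢u = ⊥-elim (u≢u refl)

⊤-summation : Summation ⊤
⊤-summation = record
  { ∑ = λ f → f tt
  ; ∑-cong = λ f≡g → f≡g tt
  ; ∑-distrib-+ = λ _ _ → refl
  ; *-distribˡ-∑ = λ _ _ → refl
  ; ∑-mono-≤ = λ f≤g → f≤g tt
  }

_⊎-summation_ : ∀ {I J} → Summation I → Summation J → Summation (I ⊎ J)
S ⊎-summation T = record
  { ∑ = λ f → ∑ S (f ∘ inj₁) + ∑ T (f ∘ inj₂)
  ; ∑-cong = λ f≡g → cong₂ _+_ (∑-cong S (f≡g ∘ inj₁)) (∑-cong T (f≡g ∘ inj₂))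
  ; ∑-distrib-+ = λ f g → trans (cong₂ _+_ (∑-distrib-+ S (f ∘ inj₁) (g ∘ inj₁)) (∑-distrib-+ T (f ∘ inj₂) (g ∘ inj₂)))
      (+-interchange (∑ S (f ∘ inj₁)) (∑ S (g ∘ inj₁)) (∑ T (f ∘ inj₂)) (∑ T (g ∘ inj₂)))
  ; *-distribˡ-∑ = λ c f → trans (*-distribˡ-+ c _ _) (cong₂ _+_ (*-distribˡ-∑ S c (f ∘ inj₁)) (*-distribˡ-∑ T c (f ∘ inj₂)))
  ; ∑-mono-≤ = λ f≤g → +-mono-≤ (∑-mono-≤ S (f≤g ∘ inj₁)) (∑-mono-≤ T (f≤g ∘ inj₂))
  }

_×-summation_ : ∀ {I J} → Summation I → Summation J → Summation (I × J)
S ×-summation T = record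
  { ∑ = λ f → ∑ S (λ i → ∑ T (λ j → f (i , j)))
  ; ∑-cong = λ f≡g → ∑-cong S (λ i → ∑-cong T (λ j → f≡g (i , j)))
  ; ∑-distrib-+ = λ f g → trans (∑-cong S (λ i → ∑-distrib-+ T (λ j → f (i , j)) (λ j → g (i , j)))) (∑-distrib-+ S _ _)
  ; *-distribˡ-∑ = λ c f → trans (*-distribˡ-∑ S c _) (∑-cong S (λ i → *-distribˡ-∑ T c (λ j → f (i , j))))
  ; ∑-mono-≤ = λ f≤g → ∑-mono-≤ S (λ i → ∑-mono-≤ T (λ j → f≤g (i , j)))
  }

-- Their ∑ are sumRow n and sumCol n m by definition, so residual² is a double ∑.
rowSummation : ∀ n → Summation (Row n)
rowSummation n = finSummation n ⊎-summation (finSummation 3 ⊎-summation ⊤-summation)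

colSummation : ∀ n m → Summation (Col n m)
colSummation n m = (finSummation 3 ×-summation finSummation n) ⊎-summation finSummation m

Interchange : ∀ {I J} → Summation I → Summation J → Set
Interchange {I} {J} S T = ∀ (f : I → J → ℚ) → ∑ S (λ i → ∑ T (f i)) ≡ ∑ T (λ j → ∑ S (λ i → f i j))

interchange-fin : ∀ {I} (S : Summation I) k → Interchange S (finSummation k)
interchange-fin S zero    f = ∑-zero S
interchange-fin S (suc k) f = trans (∑-distrib-+ S (λ i → f i fzero) (λ i → sumFin k (λ j → f i (fsuc j))))
  (cong (∑ S (λ i → f i fzero) +_) (interchange-fin S k (λ i j → f i (fsuc j))))

interchange-⊎ : ∀ {I J K} {S : Summation I} {T : Summation J} {U : Summation K} →
  Interchange S T → Interchange S U → Interchange S (T ⊎-summation U)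
interchange-⊎ {S = S} {T = T} {U = U} S⇄T S⇄U f =
  trans (∑-distrib-+ S (λ i → ∑ T (f i ∘ inj₁)) (λ i → ∑ U (f i ∘ inj₂)))
        (cong₂ _+_ (S⇄T (λ i → f i ∘ inj₁)) (S⇄U (λ i → f i ∘ inj₂)))

interchange-× : ∀ {I J K} {S : Summation I} {T : Summation J} {U : Summation K} →
  Interchange S T → Interchange S U → Interchange S (T ×-summation U)
interchange-× {T = T} {U = U} S⇄T S⇄U f =
  trans (S⇄T (λ i j → ∑ U (λ k → f i (j , k)))) (∑-cong T (λ j → S⇄U (λ i k → f i (j , k))))

rows⇄cols : ∀ n m → Interchange (rowSummation n) (colSummation n m)
rows⇄cols n m =
  interchange-⊎ {S = R} {T = finSummation 3 ×-summation finSummation n} {U = finSummation m}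
    (interchange-× {S = R} {T = finSummation 3} {U = finSummation n} (interchange-fin R 3) (interchange-fin R n))
    (interchange-fin R m)
  where R = rowSummation n

Dependent : ∀ {m n} → (Fin m → Fin n → ℚ) → Set
Dependent {m} {n} B = ∃ λ (y : Fin m → ℚ) → (∃ λ j → y j ≢ 0ℚ) × (∀ k → sumFin m (λ j → y j * B j k) ≡ 0ℚ)

zero-row⇒dependent : ∀ {m n} (B : Fin (suc m) → Fin n → ℚ) → (∀ k → B fzero k ≡ 0ℚ) → Dependent B
zero-row⇒dependent {m} B row₀≡0 = e₀ , (fzero , 1≢0) , e₀-kernel
  where
  e₀ : Fin (suc m) → ℚ
  e₀ fzero    = 1ℚ
  e₀ (fsuc _) = 0ℚ
  e₀-kernel : ∀ k → sumFin (suc m) (λ j → e₀ j * B j k) ≡ 0ℚ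
  e₀-kernel k = begin
    1ℚ * B fzero k + sumFin m (λ j → 0ℚ * B (fsuc j) k)
      ≡⟨ cong₂ _+_ (trans (*-identityˡ (B fzero k)) (row₀≡0 k))
                   (trans (sumFin-cong m (λ j → *-zeroˡ (B (fsuc j) k))) (∑-zero (finSummation m))) ⟩
    0ℚ + 0ℚ
      ≡⟨ +-identityˡ 0ℚ ⟩
    0ℚ ∎
    where open ≡-Reasoning

eliminate : ∀ {m n} (B : Fin (suc m) → Fin n → ℚ) (k₀ : Fin n) → .{{_ : ℚ.NonZero (B fzero k₀)}} → Fin m → Fin n → ℚ
eliminate B k₀ j k = B (fsuc j) k - (B (fsuc j) k₀ ÷ B fzero k₀) * B fzero k

eliminate-pivot : ∀ {m n} (B : Fin (suc m) → Fin n → ℚ) k₀ .{{_ : ℚ.NonZero (B fzero k₀)}} j → eliminate B k₀ j k₀ ≡ 0ℚ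
eliminate-pivot B k₀ j = begin
  b - (b * ℚ.1/ p) * p  ≡⟨ cong (λ x → b - x) (*-assoc b (ℚ.1/ p) p) ⟩
  b - b * (ℚ.1/ p * p)  ≡⟨ cong (λ x → b - b * x) (*-inverseˡ p) ⟩
  b - b * 1ℚ            ≡⟨ cong (λ x → b - x) (*-identityʳ b) ⟩
  b - b                 ≡⟨ +-inverseʳ b ⟩
  0ℚ                    ∎
  where
  open ≡-Reasoning
  p = B fzero k₀
  b = B (fsuc j) k₀

pivot⇒dependent : ∀ {m n} (B : Fin (suc m) → Fin (suc n) → ℚ) k₀ .{{_ : ℚ.NonZero (B fzero k₀)}} →
  Dependent (λ j k → eliminate B k₀ j (punchIn k₀ k)) → Dependent B
pivot⇒dependent {m} B k₀ (y′ , (j′ , y′j′≢0) , y′-kernel) = y , (fsuc j′ , y′j′≢0) , y-kernel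
  where
  c : Fin m → ℚ
  c j = B (fsuc j) k₀ ÷ B fzero k₀
  y : Fin (suc m) → ℚ
  y fzero    = - sumFin m (λ j → y′ j * c j)
  y (fsuc j) = y′ j
  combination : ∀ k → sumFin (suc m) (λ j → y j * B j k) ≡ sumFin m (λ j → y′ j * eliminate B k₀ j k)
  combination k = sym (begin
    sumFin m (λ j → y′ j * (B (fsuc j) k - c j * B fzero k))
      ≡⟨ sumFin-cong m (λ j → solve 4 (λ y b c b₀ → y :* (b :- c :* b₀) := y :* b :- (y :* c) :* b₀)
                                   refl (y′ j) (B (fsuc j) k) (c j) (B fzero k)) ⟩
    sumFin m (λ j → y′ j * B (fsuc j) k - (y′ j * c j) * B fzero k)
      ≡⟨ ∑-distrib-- (finSummation m) (λ j → y′ j * B (fsuc j) k) (λ j → (y′ j * c j) * B fzero k) ⟩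
    Y′B - sumFin m (λ j → (y′ j * c j) * B fzero k)
      ≡⟨ cong (λ x → Y′B - x) (*-distribʳ-sumFin m (B fzero k) (λ j → y′ j * c j)) ⟨
    Y′B - Y′c * B fzero k
      ≡⟨ solve 3 (λ s t b₀ → s :- t :* b₀ := (:- t) :* b₀ :+ s) refl Y′B Y′c (B fzero k) ⟩
    (- Y′c) * B fzero k + Y′B ∎)
    where
    open ≡-Reasoning
    Y′B = sumFin m (λ j → y′ j * B (fsuc j) k)
    Y′c = sumFin m (λ j → y′ j * c j)
  y-kernel : ∀ k → sumFin (suc m) (λ j → y j * B j k) ≡ 0ℚ
  y-kernel k with k₀ ≟ k
  ... | yes refl = trans (combination k₀)
    (trans (sumFin-cong m (λ j → trans (cong (y′ j *_) (eliminate-pivot B k₀ j)) (*-zeroʳ (y′ j)))) (∑-zero (finSummation m)))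
  ... | no k₀≢k = trans (combination k) (subst (λ k → sumFin m (λ j → y′ j * eliminate B k₀ j k) ≡ 0ℚ)
    (punchIn-punchOut k₀≢k) (y′-kernel (punchOut k₀≢k)))

n<m⇒dependent : ∀ {m n} (B : Fin m → Fin n → ℚ) → n ℕ.< m → Dependent B
n<m⇒dependent {suc m} {zero} B _ = (λ _ → 1ℚ) , (fzero , 1≢0) , λ ()
n<m⇒dependent {suc m} {suc n} B (ℕ.s<s n<m) with all? (λ k → B fzero k ℚ.≟ 0ℚ)
... | yes row₀≡0 = zero-row⇒dependent B row₀≡0
... | no  row₀≢0 with k₀ , p≢0 ← ¬∀⟶∃¬ (suc n) _ (λ k → B fzero k ℚ.≟ 0ℚ) row₀≢0 =
  pivot⇒dependent B k₀ (n<m⇒dependent (λ j k → eliminate B k₀ j (punchIn k₀ k)) n<m)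
  where instance _ = ℚ.≢-nonZero p≢0

module _ {R C : Set} (SR : Summation R) (SC : Summation C) (R⇄C : Interchange SR SC) {n : ℕ}
         (M : R → C → ℚ) (S : R → Fin n → ℚ) (A : Fin n → C → ℚ) where

  open Summation SR using (_ᵀ·_) renaming (‖_‖² to ‖_‖²ᴿ)
  open Summation SC using () renaming (‖_‖² to ‖_‖²ᶜ)

  M-SA : R → C → ℚ
  M-SA r c = M r c - sumFin n (λ k → S r k * A k c)

  ᵀ·-annihilates-SA : ∀ y → (∀ k → (y ᵀ· S) k ≡ 0ℚ) → ∀ c → (y ᵀ· M-SA) c ≡ (y ᵀ· M) c
  ᵀ·-annihilates-SA y yᵀS≡0 c = begin
    ∑ SR (λ r → y r * (M r c - SA r))
      ≡⟨ ∑-cong SR (λ r → solve 3 (λ y a b → y :* (a :- b) := y :* a :- y :* b) refl (y r) (M r c) (SA r)) ⟩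
    ∑ SR (λ r → y r * M r c - y r * SA r)
      ≡⟨ ∑-distrib-- SR (λ r → y r * M r c) (λ r → y r * SA r) ⟩
    (y ᵀ· M) c - ∑ SR (λ r → y r * SA r)
      ≡⟨ cong (λ x → (y ᵀ· M) c - x) yᵀSA≡0 ⟩
    (y ᵀ· M) c - 0ℚ
      ≡⟨ solve 1 (λ x → x :- con 0ℚ := x) refl ((y ᵀ· M) c) ⟩
    (y ᵀ· M) c ∎
    where
    open ≡-Reasoning
    SA : R → ℚ
    SA r = sumFin n (λ k → S r k * A k c)
    yᵀSA≡0 : ∑ SR (λ r → y r * SA r) ≡ 0ℚ
    yᵀSA≡0 = begin
      ∑ SR (λ r → y r * SA r)
        ≡⟨ ∑-cong SR (λ r → trans (*-distribˡ-sumFin n (y r) (λ k → S r k * A k c))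
             (sumFin-cong n (λ k → solve 3 (λ y s a → y :* (s :* a) := a :* (y :* s)) refl (y r) (S r k) (A k c)))) ⟩
      ∑ SR (λ r → sumFin n (λ k → A k c * (y r * S r k)))
        ≡⟨ interchange-fin SR n (λ r k → A k c * (y r * S r k)) ⟩
      sumFin n (λ k → ∑ SR (λ r → A k c * (y r * S r k)))
        ≡⟨ sumFin-cong n (λ k → trans (sym (*-distribˡ-∑ SR (A k c) (λ r → y r * S r k)))
             (trans (cong (A k c *_) (yᵀS≡0 k)) (*-zeroʳ (A k c)))) ⟩
      sumFin n (λ _ → 0ℚ)
        ≡⟨ ∑-zero (finSummation n) ⟩
      0ℚ ∎

  annihilator-bound : ∀ y → (∀ k → (y ᵀ· S) k ≡ 0ℚ) → 0ℚ < ‖ y ‖²ᴿ →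
    ‖ y ᵀ· M ‖²ᶜ ≤ ‖ y ‖²ᴿ * ∑ SR (λ r → ‖ M-SA r ‖²ᶜ)
  annihilator-bound y yᵀS≡0 0<‖y‖ = begin
    ∑ SC (λ c → (y ᵀ· M) c * (y ᵀ· M) c)
      ≡⟨ ∑-cong SC (λ c → cong₂ _*_ (ᵀ·-annihilates-SA y yᵀS≡0 c) (ᵀ·-annihilates-SA y yᵀS≡0 c)) ⟨
    ∑ SC (λ c → (y ᵀ· M-SA) c * (y ᵀ· M-SA) c)
      ≤⟨ ∑-mono-≤ SC (λ c → cauchy-schwarz SR y (λ r → M-SA r c) 0<‖y‖) ⟩
    ∑ SC (λ c → ‖ y ‖²ᴿ * ‖ (λ r → M-SA r c) ‖²ᴿ)
      ≡⟨ *-distribˡ-∑ SC ‖ y ‖²ᴿ _ ⟨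
    ‖ y ‖²ᴿ * ∑ SC (λ c → ∑ SR (λ r → M-SA r c * M-SA r c))
      ≡⟨ cong (‖ y ‖²ᴿ *_) (R⇄C (λ r c → M-SA r c * M-SA r c)) ⟨
    ‖ y ‖²ᴿ * ∑ SR (λ r → ‖ M-SA r ‖²ᶜ) ∎
    where open ≤-Reasoning

injective⇒surjective : ∀ {k} {f : Fin k → Fin k} → Injective _≡_ _≡_ f → ∀ j → ∃ λ i → f i ≡ j
injective⇒surjective {suc k} {f} f-inj j with any? (λ i → f i ≟ j)
... | yes found = found
... | no  missed = contradiction (injective⇒≤ g-inj) ℕ.1+n≰n
  where
  j≢f : ∀ i → j ≢ f i
  j≢f i j≡fi = missed (i , sym j≡fi)
  g : Fin (suc k) → Fin k
  g i = punchOut (j≢f i)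
  g-inj : Injective _≡_ _≡_ g
  g-inj {i} {i′} gi≡gi′ = f-inj (punchOut-injective (j≢f i) (j≢f i′) gi≡gi′)

cover⇒image-is-graph : ∀ {n} {X Y : Set} (σ : Fin n → (X × Fin n) ⊎ Y) →
  (∀ v → ∃ λ k → ∃ λ i → σ k ≡ inj₁ (i , v)) →
  ∃ λ (ψ : Fin n → X) → ∀ c → (∃ λ k → σ k ≡ c) ⇔ (∃ λ v → c ≡ inj₁ (ψ v , v))
cover⇒image-is-graph σ cover = ψ , λ c → mk⇔ (image⇒graph c) (graph⇒image c)
  where
  κ = λ v → proj₁ (cover v)
  ψ = λ v → proj₁ (proj₂ (cover v))
  σκ : ∀ v → σ (κ v) ≡ inj₁ (ψ v , v)
  σκ v = proj₂ (proj₂ (cover v))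
  κ-inj : Injective _≡_ _≡_ κ
  κ-inj {v} {w} κv≡κw = cong proj₂ (inj₁-injective (trans (sym (σκ v)) (trans (cong σ κv≡κw) (σκ w))))
  image⇒graph : ∀ c → (∃ λ k → σ k ≡ c) → ∃ λ v → c ≡ inj₁ (ψ v , v)
  image⇒graph c (k , σk≡c) with v , κv≡k ← injective⇒surjective κ-inj k =
    v , trans (sym σk≡c) (trans (cong σ (sym κv≡k)) (σκ v))
  graph⇒image : ∀ c → (∃ λ v → c ≡ inj₁ (ψ v , v)) → ∃ λ k → σ k ≡ c
  graph⇒image c (v , c≡) = κ v , trans (σκ v) (sym c≡)

module _ (n m : ℕ) .{{_ : NonZero n}} where
  private
    instance
      m+n≢0 : NonZero (m ℕ.+ n)
      m+n≢0 = ℕ.>-nonZero (ℕ.<-≤-trans (ℕ.>-nonZero⁻¹ n) (ℕ.m≤n+m n m))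
      D≢0 : NonZero (4 ℕ.* (m ℕ.+ n) ℕ.^ 3)
      D≢0 = ℕ.m*n≢0 4 _ {{_}} {{ℕ.m^n≢0 (m ℕ.+ n) 3}}

  0<t : 0ℚ < t n m
  0<t = positive⁻¹ (t n m) {{normalize-pos 1 (4 ℕ.* (m ℕ.+ n) ℕ.^ 3)}}

  ι*t≤1 : ∀ {a} → a ℕ.≤ 4 ℕ.* (m ℕ.+ n) → ι a * t n m ≤ 1ℚ
  ι*t≤1 {a} a≤4[m+n] = begin
    ι a * t n m  ≤⟨ *-monoʳ-≤-nonNeg (t n m) {{ℚ.nonNegative (<⇒≤ 0<t)}} (ι-mono-≤ (ℕ.≤-trans a≤4[m+n] 4[m+n]≤D)) ⟩
    ι D * t n m  ≡⟨ *-comm (ι D) (t n m) ⟩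
    t n m * ι D  ≡⟨ 1/d*ι[d]≡1 D ⟩
    1ℚ           ∎
    where
    open ≤-Reasoning
    D = 4 ℕ.* (m ℕ.+ n) ℕ.^ 3
    4[m+n]≤D : 4 ℕ.* (m ℕ.+ n) ℕ.≤ D
    4[m+n]≤D = ℕ.*-monoʳ-≤ 4 (ℕ.m≤m*n (m ℕ.+ n) _ {{ℕ.m^n≢0 (m ℕ.+ n) 2}})

  private
    m≤4[m+n] : m ℕ.≤ 4 ℕ.* (m ℕ.+ n)
    m≤4[m+n] = ℕ.≤-trans (ℕ.m≤m+n m n) (ℕ.m≤n*m (m ℕ.+ n) 4)
    n≤4[m+n] : n ℕ.≤ 4 ℕ.* (m ℕ.+ n)
    n≤4[m+n] = ℕ.≤-trans (ℕ.m≤n+m n m) (ℕ.m≤n*m (m ℕ.+ n) 4)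
    4n≤4[m+n] : 4 ℕ.* n ℕ.≤ 4 ℕ.* (m ℕ.+ n)
    4n≤4[m+n] = ℕ.*-monoʳ-≤ 4 (ℕ.m≤n+m n m)
    4≤4[m+n] : 4 ℕ.≤ 4 ℕ.* (m ℕ.+ n)
    4≤4[m+n] = ℕ.*-monoʳ-≤ 4 (ℕ.>-nonZero⁻¹ (m ℕ.+ n))
    0≤t : 0ℚ ≤ t n m
    0≤t = <⇒≤ 0<t
    t≤1 : t n m ≤ 1ℚ
    t≤1 = subst (_≤ 1ℚ) (*-identityˡ (t n m)) (ι*t≤1 (ℕ.≤-trans (ℕ.s≤s ℕ.z≤n) 4≤4[m+n]))
    ι*t^[2+k]≤t : ∀ {a} → a ℕ.≤ 4 ℕ.* (m ℕ.+ n) → ∀ k → ι a * t n m ^ℚ suc (suc k) ≤ t n m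
    ι*t^[2+k]≤t {a} a≤ = c*p^[2+k]≤p (ι-nonNeg a) 0≤t t≤1 (ι*t≤1 a≤)

    0≤ι*t^k : ∀ a k → 0ℚ ≤ ι a * t n m ^ℚ k
    0≤ι*t^k a k = 0≤p*q (ι-nonNeg a) (0≤p^k 0≤t k)

  0≤bound² : 0ℚ ≤ bound² n m
  0≤bound² = +-mono-≤ (+-mono-≤ (0≤ι*t^k m 2) (0≤ι*t^k (4 ℕ.* n) 6)) (0≤ι*t^k m 10)

  bound²-small : (1ℚ + ι n * t n m ^ℚ 2) * bound² n m < ι 3
  bound²-small = begin-strict
    (1ℚ + ι n * t n m ^ℚ 2) * bound² n m
      ≤⟨ *-mono-≤-nonNeg 0≤1+q (+-monoʳ-≤ 1ℚ (≤-trans (ι*t^[2+k]≤t n≤4[m+n] 0) t≤1)) (0≤bound²) bound²≤3t ⟩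
    (1ℚ + 1ℚ) * (ι 3 * t n m)
      ≡⟨ solve 1 (λ x → (con 1ℚ :+ con 1ℚ) :* (con (ι 3) :* x) := con (ι 3) :* (con (ι 2) :* x)) refl (t n m) ⟩
    ι 3 * (ι 2 * t n m)
      <⟨ *-monoʳ-<-pos (ι 3) {{_}} 2t<1 ⟩
    ι 3 * 1ℚ
      ≡⟨ *-identityʳ (ι 3) ⟩
    ι 3 ∎
    where
    open ≤-Reasoning
    0≤1+q : 0ℚ ≤ 1ℚ + ι n * t n m ^ℚ 2
    0≤1+q = +-mono-≤ 0≤1 (0≤ι*t^k n 2)
    bound²≤3t : bound² n m ≤ ι 3 * t n m
    bound²≤3t = begin
      bound² n m
        ≤⟨ +-mono-≤ (+-mono-≤ (ι*t^[2+k]≤t m≤4[m+n] 0) (ι*t^[2+k]≤t 4n≤4[m+n] 4)) (ι*t^[2+k]≤t m≤4[m+n] 8) ⟩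
      t n m + t n m + t n m
        ≡⟨ solve 1 (λ x → x :+ x :+ x := con (ι 3) :* x) refl (t n m) ⟩
      ι 3 * t n m ∎
    2t<1 : ι 2 * t n m < 1ℚ
    2t<1 = <-≤-trans (*-monoˡ-<-pos (t n m) {{ℚ.positive 0<t}} ι2<ι4) (ι*t≤1 4≤4[m+n])

module _ {n m : ℕ} .{{_ : NonZero n}} (G : SimpleGraph n m) where
  private
    M = 𝓜 n m G
    ε : Row n
    ε = inj₂ (inj₂ tt)
  open Summation (rowSummation n) using (_ᵀ·_)
  open Summation (colSummation n m) using () renaming (‖_‖² to ‖_‖²ᶜ)

  𝓜-vertex-edge : ∀ v e → M (inj₁ v) (inj₂ e) ≡ 0ℚ ⊎ M (inj₁ v) (inj₂ e) ≡ t n m ^ℚ 2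
  𝓜-vertex-edge v e with v ≟ proj₁ (SimpleGraph.edge G e) | v ≟ proj₂ (SimpleGraph.edge G e)
  ... | no _  | no _  = inj₁ refl
  ... | yes _ | _     = inj₂ refl
  ... | no _  | yes _ = inj₂ refl

  edge-column-norm : ∀ e →
    sumFin n (λ v → M (inj₁ v) (inj₂ e) * M (inj₁ v) (inj₂ e)) ≤ ι n * (t n m ^ℚ 2 * t n m ^ℚ 2)
  edge-column-norm e = ≤-trans (sumFin-mono-≤ n entry²≤) (≤-reflexive (sumFin-const n (t n m ^ℚ 2 * t n m ^ℚ 2)))
    where
    entry²≤ : ∀ v → M (inj₁ v) (inj₂ e) * M (inj₁ v) (inj₂ e) ≤ t n m ^ℚ 2 * t n m ^ℚ 2
    entry²≤ v = [ (λ entry≡0 → subst (λ x → x * x ≤ t n m ^ℚ 2 * t n m ^ℚ 2) (sym entry≡0) (0≤p*p (t n m ^ℚ 2)))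
                , (λ entry≡t² → ≤-reflexive (cong (λ x → x * x) entry≡t²)) ]′ (𝓜-vertex-edge v e)

  sumFin-*-𝓜-vertex : ∀ (f : Fin n → ℚ) i w → sumFin n (λ v → f v * M (inj₁ v) (inj₁ (i , w))) ≡ f w
  sumFin-*-𝓜-vertex f i w =
    trans (sumFin-concentrated n (λ v → f v * M (inj₁ v) (inj₁ (i , w))) w off-diagonal)
          (trans (cong (f w *_) diagonal) (*-identityʳ (f w)))
    where
    diagonal : M (inj₁ w) (inj₁ (i , w)) ≡ 1ℚ
    diagonal with w ≟ w
    ... | yes _  = refl
    ... | no w≢w = ⊥-elim (w≢w refl)
    off-diagonal : ∀ v → v ≢ w → f v * M (inj₁ v) (inj₁ (i , w)) ≡ 0ℚ
    off-diagonal v v≢w with v ≟ w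
    ... | yes v≡w = ⊥-elim (v≢w v≡w)
    ... | no _    = *-zeroʳ (f v)

  V∪ε-vector : (Fin n → ℚ) → ℚ → Row n → ℚ
  V∪ε-vector yV yε (inj₁ v)         = yV v
  V∪ε-vector yV yε (inj₂ (inj₁ _))  = 0ℚ
  V∪ε-vector yV yε (inj₂ (inj₂ tt)) = yε

  V∪ε-vectorᵀ·𝓜 : ∀ yV yε c → (V∪ε-vector yV yε ᵀ· M) c ≡ sumFin n (λ v → yV v * M (inj₁ v) c) + yε * M ε c
  V∪ε-vectorᵀ·𝓜 yV yε c = cong (sumFin n (λ v → yV v * M (inj₁ v) c) +_)
    (trans (cong (_+ yε * M ε c) (trans (sumFin-cong 3 (λ j → *-zeroˡ (M (inj₂ (inj₁ j)) c))) (∑-zero (finSummation 3))))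
           (+-identityˡ (yε * M ε c)))

  V∪ε-vectorᵀ·𝓜-vertex : ∀ yV yε i w → (V∪ε-vector yV yε ᵀ· M) (inj₁ (i , w)) ≡ yV w
  V∪ε-vectorᵀ·𝓜-vertex yV yε i w = begin
    (V∪ε-vector yV yε ᵀ· M) (inj₁ (i , w))                      ≡⟨ V∪ε-vectorᵀ·𝓜 yV yε (inj₁ (i , w)) ⟩
    sumFin n (λ v → yV v * M (inj₁ v) (inj₁ (i , w))) + yε * 0ℚ  ≡⟨ cong₂ _+_ (sumFin-*-𝓜-vertex yV i w) (*-zeroʳ yε) ⟩
    yV w + 0ℚ                                                   ≡⟨ +-identityʳ (yV w) ⟩
    yV w                                                        ∎
    where open ≡-Reasoning

  3‖yV‖²≤‖yᵀ𝓜‖² : ∀ yV yε → ι 3 * sumFin n (λ v → yV v * yV v) ≤ ‖ V∪ε-vector yV yε ᵀ· M ‖²ᶜ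
  3‖yV‖²≤‖yᵀ𝓜‖² yV yε = begin
    ι 3 * Y
      ≡⟨ sumFin-const 3 Y ⟨
    sumFin 3 (λ _ → Y)
      ≡⟨ sumFin-cong 3 (λ i → sumFin-cong n (λ w → cong₂ _*_ (vertex i w) (vertex i w))) ⟨
    sumFin 3 (λ i → sumFin n (λ w → yᵀ𝓜 (inj₁ (i , w)) * yᵀ𝓜 (inj₁ (i , w))))
      ≤⟨ p≤p+q (∑-nonNeg (finSummation m) (λ e → 0≤p*p (yᵀ𝓜 (inj₂ e)))) ⟩
    ‖ yᵀ𝓜 ‖²ᶜ ∎
    where
    open ≤-Reasoning
    Y = sumFin n (λ v → yV v * yV v)
    yᵀ𝓜 = V∪ε-vector yV yε ᵀ· M
    vertex = V∪ε-vectorᵀ·𝓜-vertex yV yε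

module Selection {n m : ℕ} .{{_ : NonZero n}} (G : SimpleGraph n m) (σ : Fin n → Col n m)
                 (A : Fin n → Col n m → ℚ) (small : residual² n m G σ A ≤ bound² n m) where
  private
    M = 𝓜 n m G
    ε : Row n
    ε = inj₂ (inj₂ tt)
    S : Row n → Fin n → ℚ
    S r k = M r (σ k)
    q = ι n * t n m ^ℚ 2
  open Summation (rowSummation n) using (_ᵀ·_)

  no-small-annihilator : ∀ yV yε → (∀ k → (V∪ε-vector G yV yε ᵀ· S) k ≡ 0ℚ) →
    0ℚ < sumFin n (λ v → yV v * yV v) → yε * yε ≤ sumFin n (λ v → yV v * yV v) * q → ⊥
  no-small-annihilator yV yε yᵀS≡0 0<Y yε²≤Yq = <-irrefl refl (begin-strict
    ι 3 * Y                      ≤⟨ 3‖yV‖²≤‖yᵀ𝓜‖² G yV yε ⟩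
    ‖ y ᵀ· M ‖²ᶜ                 ≤⟨ annihilator-bound (rowSummation n) (colSummation n m) (rows⇄cols n m) M S A y yᵀS≡0 0<‖y‖² ⟩
    ‖ y ‖²ʳ * residual² n m G σ A ≤⟨ *-monoˡ-≤-nonNeg ‖ y ‖²ʳ {{ℚ.nonNegative (<⇒≤ 0<‖y‖²)}} small ⟩
    ‖ y ‖²ʳ * bound² n m         ≤⟨ *-monoʳ-≤-nonNeg (bound² n m) {{ℚ.nonNegative (0≤bound² n m)}} ‖y‖²≤Y[1+q] ⟩
    Y * (1ℚ + q) * bound² n m    ≡⟨ *-assoc Y (1ℚ + q) (bound² n m) ⟩
    Y * ((1ℚ + q) * bound² n m)  <⟨ *-monoʳ-<-pos Y {{ℚ.positive 0<Y}} (bound²-small n m) ⟩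
    Y * ι 3                      ≡⟨ *-comm Y (ι 3) ⟩
    ι 3 * Y                      ∎)
    where
    open ≤-Reasoning
    open Summation (rowSummation n) using () renaming (‖_‖² to ‖_‖²ʳ)
    open Summation (colSummation n m) using () renaming (‖_‖² to ‖_‖²ᶜ)
    Y = sumFin n (λ v → yV v * yV v)
    y = V∪ε-vector G yV yε
    ‖y‖²≡Y+yε² : ‖ y ‖²ʳ ≡ Y + yε * yε
    ‖y‖²≡Y+yε² = cong (Y +_) (+-identityˡ (yε * yε))
    0<‖y‖² : 0ℚ < ‖ y ‖²ʳ
    0<‖y‖² = <-≤-trans 0<Y (subst (Y ≤_) (sym ‖y‖²≡Y+yε²) (p≤p+q (0≤p*p yε)))
    ‖y‖²≤Y[1+q] : ‖ y ‖²ʳ ≤ Y * (1ℚ + q)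
    ‖y‖²≤Y[1+q] = subst₂ _≤_ (sym ‖y‖²≡Y+yε²) (solve 2 (λ Y q → Y :+ Y :* q := Y :* (con 1ℚ :+ q)) refl Y q)
                         (+-monoʳ-≤ Y yε²≤Yq)

  private
    rowOf : Fin (suc n) → Row n
    rowOf fzero    = ε
    rowOf (fsuc v) = inj₁ v

  -- The n + 1 rows V ∪ {ε} of S are dependent.  In the edge column the ε-entry t has to be
  -- balanced by vertex entries of size t², which makes the ε-coefficient small.
  no-edge-column : ∀ k₀ e → σ k₀ ≢ inj₂ e
  no-edge-column k₀ e σk₀≡e = contradiction (n<m⇒dependent (λ j k → S (rowOf j) k) (ℕ.n<1+n n)) ¬dependent
    where
    ¬dependent : ¬ Dependent (λ j k → S (rowOf j) k)
    ¬dependent (z , (j , zj≢0) , z-kernel) = no-small-annihilator yV yε yᵀS≡0 0<Y yε²≤Yq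
      where
      yε = z fzero
      yV = z ∘ fsuc
      Y = sumFin n (λ v → yV v * yV v)
      Sv = sumFin n (λ v → yV v * M (inj₁ v) (inj₂ e))
      yᵀS≡0 : ∀ k → (V∪ε-vector G yV yε ᵀ· S) k ≡ 0ℚ
      yᵀS≡0 k = trans (V∪ε-vectorᵀ·𝓜 G yV yε (σ k)) (trans (+-comm _ (yε * M ε (σ k))) (z-kernel k))
      edge-equation : Sv + yε * t n m ≡ 0ℚ
      edge-equation = trans (sym (V∪ε-vectorᵀ·𝓜 G yV yε (inj₂ e)))
                            (subst (λ c → (V∪ε-vector G yV yε ᵀ· M) c ≡ 0ℚ) σk₀≡e (yᵀS≡0 k₀))
      yεt≡-Sv : yε * t n m ≡ - Sv
      yεt≡-Sv = begin
        yε * t n m             ≡⟨ solve 2 (λ s a → a := (s :+ a) :- s) refl Sv (yε * t n m) ⟩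
        Sv + yε * t n m - Sv   ≡⟨ cong (_- Sv) edge-equation ⟩
        0ℚ - Sv                ≡⟨ +-identityˡ (- Sv) ⟩
        - Sv                   ∎
        where open ≡-Reasoning
      0<Y : 0ℚ < Y
      0<Y = [ id , (λ yV≡0 → contradiction (z≡0 yV≡0 j) zj≢0) ]′ (0<∑f²⊎f≡0 yV)
        where
        Sv≡0 : (∀ v → yV v ≡ 0ℚ) → Sv ≡ 0ℚ
        Sv≡0 yV≡0 = trans (sumFin-cong n (λ v → trans (cong (_* M (inj₁ v) (inj₂ e)) (yV≡0 v)) (*-zeroˡ (M (inj₁ v) (inj₂ e)))))
                          (∑-zero (finSummation n))
        z≡0 : (∀ v → yV v ≡ 0ℚ) → ∀ j → z j ≡ 0ℚ
        z≡0 yV≡0 fzero    = p*q≡0⇒p≡0 (t n m) {{pos⇒nonZero (t n m) {{ℚ.positive (0<t n m)}}}}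
                              (trans yεt≡-Sv (cong -_ (Sv≡0 yV≡0)))
        z≡0 yV≡0 (fsuc v) = yV≡0 v
      yε²≤Yq : yε * yε ≤ Y * q
      yε²≤Yq = *-cancelˡ-≤-pos (t n m ^ℚ 2) {{ℚ.positive (0<p^k (0<t n m) 2)}} (begin
        t n m ^ℚ 2 * (yε * yε)
          ≡⟨ solve 2 (λ x y → (x :* (x :* con 1ℚ)) :* (y :* y) := (y :* x) :* (y :* x)) refl (t n m) yε ⟩
        (yε * t n m) * (yε * t n m)
          ≡⟨ cong₂ _*_ yεt≡-Sv yεt≡-Sv ⟩
        (- Sv) * (- Sv)
          ≡⟨ solve 1 (λ s → (:- s) :* (:- s) := s :* s) refl Sv ⟩
        Sv * Sv
          ≤⟨ cauchy-schwarz (finSummation n) yV (λ v → M (inj₁ v) (inj₂ e)) 0<Y ⟩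
        Y * sumFin n (λ v → M (inj₁ v) (inj₂ e) * M (inj₁ v) (inj₂ e))
          ≤⟨ *-monoˡ-≤-nonNeg Y {{ℚ.nonNegative (<⇒≤ 0<Y)}} (edge-column-norm G e) ⟩
        Y * (ι n * (t n m ^ℚ 2 * t n m ^ℚ 2))
          ≡⟨ solve 3 (λ Y i x → Y :* (i :* (x :* x)) := x :* (Y :* (i :* x))) refl Y (ι n) (t n m ^ℚ 2) ⟩
        t n m ^ℚ 2 * (Y * q) ∎)
        where open ≤-Reasoning

  private
    _≟ᶜ_ : (c d : Col n m) → Dec (c ≡ d)
    _≟ᶜ_ = ≡-dec (×-≡-dec _≟_ _≟_) _≟_

  -- Since every column of S is a vertex column, a vertex u with no selected copy makes
  -- the indicator of u an annihilator of S.
  every-vertex-selected : ∀ u → ∃ λ k → ∃ λ i → σ k ≡ inj₁ (i , u)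
  every-vertex-selected u = decidable-stable (any? (λ k → any? (λ i → σ k ≟ᶜ inj₁ (i , u)))) λ unselected →
    no-small-annihilator (indicator u) 0ℚ (yᵀS≡0 unselected) (0<∑f² (indicator u) u (indicator-on u))
      (0≤p*q (∑-nonNeg (finSummation n) (λ v → 0≤p*p (indicator u v))) (0≤p*q (ι-nonNeg n) (0≤p^k (<⇒≤ (0<t n m)) 2)))
    where
    yᵀS≡0 : ¬ (∃ λ k → ∃ λ i → σ k ≡ inj₁ (i , u)) → ∀ k → (V∪ε-vector G (indicator u) 0ℚ ᵀ· S) k ≡ 0ℚ
    yᵀS≡0 unselected k = at-column (σ k) refl
      where
      at-column : ∀ c → σ k ≡ c → (V∪ε-vector G (indicator u) 0ℚ ᵀ· M) c ≡ 0ℚ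
      at-column (inj₂ e)       σk≡e = contradiction σk≡e (no-edge-column k e)
      at-column (inj₁ (i , w)) σk≡c = trans (V∪ε-vectorᵀ·𝓜-vertex G (indicator u) 0ℚ i w)
        (indicator-off u w (λ { refl → unselected (k , i , σk≡c) }))

lemma4p3 : (n m : ℕ) → .{{_ : NonZero n}} → .{{_ : NonZero m}} →
    (G : SimpleGraph n m) →
    (σ : Fin n → Col n m) → (∀ k l → σ k ≡ σ l → k ≡ l) →
    (∃ λ (A : Fin n → Col n m → ℚ) → residual² n m G σ A ≤ bound² n m) →
    ∃ λ (ψ : Fin n → Fin 3) →
      ∀ (c : Col n m) → (∃ λ k → σ k ≡ c) ⇔ (∃ λ v → c ≡ inj₁ (ψ v , v))
lemma4p3 n m G σ _ (A , small) = cover⇒image-is-graph σ (Selection.every-vertex-selected G σ A small)
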